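{- Let $P$ be a PLSC of order $n$ in which automatic elimination has been performed, and suppose the primary extension procedure applied to $P$ does not stop because of an eliminated file; let $P^*$ be its (unique) result, the primary extension of $P$. Then a set $Q$ of cells is a completion of $P$ if and only if it is a completion of $P^*$. In particular, if every line of $P^*$ contains a rook, then $P$ has exactly one completion, namely the set of rook cells of $P^*$.
   Context: A PLSC (partial Latin super cube) of order $n$ is an assignment to each cell of $\{1,\ldots,n\}^3$ of one of three states: rook, dot, or empty, such that no two rooks lie on a common line (a line, or file, is a set of $n$ cells obtained by fixing two coordinates). Automatic elimination means making empty every dot that lies on a line containing a rook. An eliminated file is a line containing neither a rook nor a dot. A dot is desolate if some line contains it as its only dot (and no rook). The primary extension procedure: start with $P_0=P$; repeatedly: if every line contains a rook, stop; if there is an eliminated file, stop; if there is no desolate dot, stop; otherwise select an arbitrary desolate dot, replace it by a rook, perform automatic elimination, and repeat. A completion of a PLSC $P$ is a set $Q$ of $n^2$ cells (a Latin super cube) containing exactly one cell of every line, containing every rook cell of $P$, and such that every cell of $Q$ is a rook cell or a dot cell of $P$. -}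

module Defs where

open import Data.Nat using (ℕ)
open import Data.Fin using (Fin)
open import Data.Fin.Properties renaming (_≟_ to _≟ᶠ_)
open import Data.Product using (Σ; ∃; _×_; _,_)
open import Data.Sum using (_⊎_)
open import Data.Bool using (Bool; true)
open import Relation.Nullary using (¬_; yes; no)
open import Relation.Binary.PropositionalEquality using (_≡_; _≢_)
open import Relation.Binary.Construct.Closure.ReflexiveTransitive using (Star)

data State : Set where
  rook dot empty : State

-- Cells of the cube {1..n}^3 (0-indexed).
Cell : ℕ → Set
Cell n = Fin n × Fin n × Fin n

-- A line (file) is given by the coordinate that varies and the values of the
-- two fixed coordinates.
data Dir : Set where
  dx dy dz : Dir

Line : ℕ → Set
Line n = Dir × Fin n × Fin n

OnLine : ∀ {n} → Line n → Cell n → Set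
OnLine (dx , a , b) (x , y , z) = (y ≡ a) × (z ≡ b)
OnLine (dy , a , b) (x , y , z) = (x ≡ a) × (z ≡ b)
OnLine (dz , a , b) (x , y , z) = (x ≡ a) × (y ≡ b)

Config : ℕ → Set
Config n = Cell n → State

IsPLSC : ∀ {n} → Config n → Set
IsPLSC {n} P = ∀ (L : Line n) (c c′ : Cell n) → OnLine L c → OnLine L c′ →
  P c ≡ rook → P c′ ≡ rook → c ≡ c′

HasRook : ∀ {n} → Config n → Line n → Set
HasRook P L = ∃ λ c → OnLine L c × (P c ≡ rook)

HitDot : ∀ {n} → Config n → Cell n → Set
HitDot {n} P c = (P c ≡ dot) × ∃ λ (L : Line n) → OnLine L c × HasRook P L

AutoEliminated : ∀ {n} → Config n → Set
AutoEliminated P = ∀ c → ¬ HitDot P c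

Elim : ∀ {n} → Config n → Config n → Set
Elim P P′ = ∀ c → (HitDot P c → P′ c ≡ empty) × (¬ HitDot P c → P′ c ≡ P c)

AllRook : ∀ {n} → Config n → Set
AllRook {n} P = ∀ (L : Line n) → HasRook P L

EliminatedFile : ∀ {n} → Config n → Line n → Set
EliminatedFile P L = ∀ c → OnLine L c → P c ≡ empty

HasEliminatedFile : ∀ {n} → Config n → Set
HasEliminatedFile {n} P = ∃ λ (L : Line n) → EliminatedFile P L

Desolate : ∀ {n} → Config n → Cell n → Set
Desolate {n} P c = (P c ≡ dot) × ∃ λ (L : Line n) → OnLine L c ×
  (∀ c′ → OnLine L c′ → P c′ ≡ dot → c′ ≡ c) ×
  (∀ c′ → OnLine L c′ → P c′ ≢ rook)

_≟ᶜ_ : ∀ {n} (c d : Cell n) → Relation.Nullary.Dec (c ≡ d)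
(x , y , z) ≟ᶜ (x′ , y′ , z′) with x ≟ᶠ x′ | y ≟ᶠ y′ | z ≟ᶠ z′
... | yes Relation.Binary.PropositionalEquality.refl | yes Relation.Binary.PropositionalEquality.refl | yes Relation.Binary.PropositionalEquality.refl = yes Relation.Binary.PropositionalEquality.refl
... | no ne | _ | _ = no λ { Relation.Binary.PropositionalEquality.refl → ne Relation.Binary.PropositionalEquality.refl }
... | yes _ | no ne | _ = no λ { Relation.Binary.PropositionalEquality.refl → ne Relation.Binary.PropositionalEquality.refl }
... | yes _ | yes _ | no ne = no λ { Relation.Binary.PropositionalEquality.refl → ne Relation.Binary.PropositionalEquality.refl }

placeRook : ∀ {n} → Config n → Cell n → Config n
placeRook P c d with d ≟ᶜ c
... | yes _ = rook
... | no _ = P d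

Stops : ∀ {n} → Config n → Set
Stops P = AllRook P ⊎ HasEliminatedFile P ⊎ (∀ c → ¬ Desolate P c)

-- One step of the primary extension procedure (only taken when no stopping
-- condition applies to the first two tests): select a desolate dot, replace it
-- by a rook, perform automatic elimination.
Step : ∀ {n} → Config n → Config n → Set
Step P P′ = ¬ AllRook P × ¬ HasEliminatedFile P ×
  ∃ λ c → Desolate P c × Elim (placeRook P c) P′

PrimaryExtension : ∀ {n} → Config n → Config n → Set
PrimaryExtension P P⋆ = Star Step P P⋆ × Stops P⋆

Completion : ∀ {n} → Config n → (Cell n → Bool) → Set
Completion {n} P Q =
  (∀ (L : Line n) → ∃ λ c → OnLine L c × (Q c ≡ true) ×
      (∀ c′ → OnLine L c′ → Q c′ ≡ true → c′ ≡ c)) ×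
  (∀ c → P c ≡ rook → Q c ≡ true) ×
  (∀ c → Q c ≡ true → (P c ≡ rook) ⊎ (P c ≡ dot))

{-# OPTIONS --safe #-}
-- Every step of the primary extension procedure preserves the set of
-- completions. A desolate dot is the only cell of its line that a completion
-- may use, so every completion contains it and turning it into a rook changes
-- nothing; automatic elimination only removes dots sharing a line with a rook,
-- and a completion, which meets that line exactly once and contains the rook,
-- never uses such a dot. Both steps keep the configuration a PLSC on which
-- automatic elimination has been performed, so induction along the run gives
-- the first claim. If every line of P⋆ carries a rook, a completion must use
-- exactly that rook on each line, so it is the rook set of P⋆.
module Submission where

open import Defs
open import Data.Nat using (ℕ)
open import Data.Product using (_×_; _,_; proj₁; proj₂; ∃)
open import Data.Sum using (_⊎_; inj₁; inj₂)
open import Data.Bool using (Bool; true)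
open import Data.Empty using (⊥-elim)
open import Relation.Nullary using (¬_; yes; no)
open import Relation.Binary.PropositionalEquality using (_≡_; _≢_; refl; sym; trans; subst)
open import Relation.Binary.Construct.Closure.ReflexiveTransitive using (Star; ε; _◅_)
open import Function.Bundles using (_⇔_; mk⇔; Equivalence)
open import Function.Construct.Identity using (⇔-id)
open import Function.Construct.Composition using (_⇔-∘_)

rook≢dot : rook ≢ dot
rook≢dot ()

rook≢empty : rook ≢ empty
rook≢empty ()

dot≢empty : dot ≢ empty
dot≢empty ()

module _ {n : ℕ} where

  placeRook-rook⊎dot : (P : Config n) (c d : Cell n) → (P d ≡ rook) ⊎ (P d ≡ dot) →
    (placeRook P c d ≡ rook) ⊎ (placeRook P c d ≡ dot)
  placeRook-rook⊎dot P c d h with d ≟ᶜ c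
  ... | yes _ = inj₁ refl
  ... | no _ = h

  placeRook-rook : (P : Config n) (c : Cell n) {d : Cell n} →
    P d ≡ rook → placeRook P c d ≡ rook
  placeRook-rook P c {d} Pd with d ≟ᶜ c
  ... | yes _ = refl
  ... | no _ = Pd

  placeRook-rook⁻ : (P : Config n) (c d : Cell n) →
    placeRook P c d ≡ rook → (d ≡ c) ⊎ (P d ≡ rook)
  placeRook-rook⁻ P c d h with d ≟ᶜ c
  ... | yes d≡c = inj₁ d≡c
  ... | no _ = inj₂ h

  placeRook-dot⁻ : (P : Config n) (c d : Cell n) →
    placeRook P c d ≡ dot → P d ≡ dot
  placeRook-dot⁻ P c d h with d ≟ᶜ c
  ... | yes _ = ⊥-elim (rook≢dot h)
  ... | no _ = h

  placeRook-IsPLSC : {P : Config n} {c : Cell n} → IsPLSC P → AutoEliminated P →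
    P c ≡ dot → IsPLSC (placeRook P c)
  placeRook-IsPLSC {P} {c} plsc ae Pc L d d′ od od′ rd rd′
    with placeRook-rook⁻ P c d rd | placeRook-rook⁻ P c d′ rd′
  ... | inj₁ d≡c | inj₁ d′≡c = trans d≡c (sym d′≡c)
  ... | inj₂ Pd | inj₂ Pd′ = plsc L d d′ od od′ Pd Pd′
  ... | inj₁ refl | inj₂ Pd′ = ⊥-elim (ae d (Pc , L , od , d′ , od′ , Pd′))
  ... | inj₂ Pd | inj₁ refl = ⊥-elim (ae d′ (Pc , L , od′ , d , od , Pd))

  module _ {R P′ : Config n} (elim : Elim R P′) where

    Elim-nonempty : {c : Cell n} → P′ c ≢ empty → P′ c ≡ R c
    Elim-nonempty {c} P′c≢empty = proj₂ (elim c) (λ hit → P′c≢empty (proj₁ (elim c) hit))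

    Elim-rook : {c : Cell n} → R c ≡ rook → P′ c ≡ rook
    Elim-rook {c} Rc = trans (proj₂ (elim c) (λ hit → rook≢dot (trans (sym Rc) (proj₁ hit)))) Rc

    Elim-rook⁻ : {c : Cell n} → P′ c ≡ rook → R c ≡ rook
    Elim-rook⁻ P′c = trans (sym (Elim-nonempty (λ e → rook≢empty (trans (sym P′c) e)))) P′c

    Elim-dot⁻ : {c : Cell n} → P′ c ≡ dot → R c ≡ dot
    Elim-dot⁻ P′c = trans (sym (Elim-nonempty (λ e → dot≢empty (trans (sym P′c) e)))) P′c

    Elim-IsPLSC : IsPLSC R → IsPLSC P′
    Elim-IsPLSC plsc L d d′ od od′ rd rd′ = plsc L d d′ od od′ (Elim-rook⁻ rd) (Elim-rook⁻ rd′)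

    Elim-AutoEliminated : AutoEliminated P′
    Elim-AutoEliminated c (P′c , L , oc , r , or , P′r) =
      dot≢empty (trans (sym P′c) (proj₁ (elim c) (Elim-dot⁻ P′c , L , oc , r , or , Elim-rook⁻ P′r)))

  Completion-desolate : {P : Config n} {Q : Cell n → Bool} {c : Cell n} →
    Completion P Q → Desolate P c → Q c ≡ true
  Completion-desolate {Q = Q} (lines , _ , ⊆rook⊎dot) (_ , L , _ , onlyDot , noRook)
    with lines L
  ... | d , od , Qd , _ with ⊆rook⊎dot d Qd
  ...   | inj₁ Pd = ⊥-elim (noRook d od Pd)
  ...   | inj₂ Pd = subst (λ x → Q x ≡ true) (onlyDot d od Pd) Qd

  Completion-dot-not-hit : {P : Config n} {Q : Cell n → Bool} {c : Cell n} →
    Completion P Q → Q c ≡ true → P c ≡ dot → ¬ HitDot P c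
  Completion-dot-not-hit {P} {c = c} (lines , rook⊆ , _) Qc Pc (_ , L , oc , r , or , Pr)
    with lines L
  ... | _ , _ , _ , unique = rook≢dot (trans (sym Pr) (subst (λ x → P x ≡ dot) c≡r Pc))
    where
    c≡r : c ≡ r
    c≡r = trans (unique c oc Qc) (sym (unique r or (rook⊆ r Pr)))

  Completion-placeRook : {P : Config n} {Q : Cell n → Bool} {c : Cell n} →
    Completion P Q → Q c ≡ true → Completion (placeRook P c) Q
  Completion-placeRook {P} {Q} {c} (lines , rook⊆ , ⊆rook⊎dot) Qc = lines , rook⊆′ , ⊆rook⊎dot′
    where
    rook⊆′ : ∀ d → placeRook P c d ≡ rook → Q d ≡ true
    rook⊆′ d rd with placeRook-rook⁻ P c d rd
    ... | inj₁ refl = Qc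
    ... | inj₂ Pd = rook⊆ d Pd
    ⊆rook⊎dot′ : ∀ d → Q d ≡ true → (placeRook P c d ≡ rook) ⊎ (placeRook P c d ≡ dot)
    ⊆rook⊎dot′ d Qd = placeRook-rook⊎dot P c d (⊆rook⊎dot d Qd)

  Completion-placeRook⁻ : {P : Config n} {Q : Cell n → Bool} {c : Cell n} → P c ≡ dot →
    Completion (placeRook P c) Q → Completion P Q
  Completion-placeRook⁻ {P} {Q} {c} Pc (lines , rook⊆ , ⊆rook⊎dot) = lines , rook⊆′ , ⊆rook⊎dot′
    where
    rook⊆′ : ∀ d → P d ≡ rook → Q d ≡ true
    rook⊆′ d Pd = rook⊆ d (placeRook-rook P c Pd)
    ⊆rook⊎dot′ : ∀ d → Q d ≡ true → (P d ≡ rook) ⊎ (P d ≡ dot)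
    ⊆rook⊎dot′ d Qd with ⊆rook⊎dot d Qd
    ... | inj₂ rd = inj₂ (placeRook-dot⁻ P c d rd)
    ... | inj₁ rd with placeRook-rook⁻ P c d rd
    ...   | inj₁ refl = inj₂ Pc
    ...   | inj₂ Pd = inj₁ Pd

  Elim-Completion : {R P′ : Config n} → Elim R P′ → (Q : Cell n → Bool) →
    Completion R Q ⇔ Completion P′ Q
  Elim-Completion {R} {P′} elim Q = mk⇔ to from
    where
    to : Completion R Q → Completion P′ Q
    to comp@(lines , rook⊆ , ⊆rook⊎dot) = lines , (λ d P′d → rook⊆ d (Elim-rook⁻ elim P′d)) , ⊆rook⊎dot′
      where
      ⊆rook⊎dot′ : ∀ d → Q d ≡ true → (P′ d ≡ rook) ⊎ (P′ d ≡ dot)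
      ⊆rook⊎dot′ d Qd with ⊆rook⊎dot d Qd
      ... | inj₁ Rd = inj₁ (Elim-rook elim Rd)
      ... | inj₂ Rd = inj₂ (trans (proj₂ (elim d) (Completion-dot-not-hit comp Qd Rd)) Rd)
    from : Completion P′ Q → Completion R Q
    from (lines , rook⊆ , ⊆rook⊎dot) = lines , rook⊆′ , ⊆rook⊎dot′
      where
      rook⊆′ : ∀ d → R d ≡ rook → Q d ≡ true
      rook⊆′ d Rd = rook⊆ d (Elim-rook elim Rd)
      ⊆rook⊎dot′ : ∀ d → Q d ≡ true → (R d ≡ rook) ⊎ (R d ≡ dot)
      ⊆rook⊎dot′ d Qd with ⊆rook⊎dot d Qd
      ... | inj₁ P′d = inj₁ (Elim-rook⁻ elim P′d)
      ... | inj₂ P′d = inj₂ (Elim-dot⁻ elim P′d)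

  SameCompletions : Config n → Config n → Set
  SameCompletions P P′ = (Q : Cell n → Bool) → Completion P Q ⇔ Completion P′ Q

  Eliminated-PLSC : Config n → Set
  Eliminated-PLSC P = IsPLSC P × AutoEliminated P

  Step-preserves : {P P′ : Config n} → Eliminated-PLSC P → Step P P′ →
    Eliminated-PLSC P′ × SameCompletions P P′
  Step-preserves (plsc , ae) (_ , _ , c , desolate@(Pc , _) , elim) =
    (Elim-IsPLSC elim (placeRook-IsPLSC plsc ae Pc) , Elim-AutoEliminated elim) ,
    λ Q → Elim-Completion elim Q ⇔-∘ mk⇔
      (λ comp → Completion-placeRook comp (Completion-desolate comp desolate))
      (Completion-placeRook⁻ Pc)

  Star-Step-preserves : {P P⋆ : Config n} → Eliminated-PLSC P → Star Step P P⋆ →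
    Eliminated-PLSC P⋆ × SameCompletions P P⋆
  Star-Step-preserves inv ε = inv , λ _ → ⇔-id _
  Star-Step-preserves inv (step ◅ steps) with Step-preserves inv step
  ... | inv′ , same with Star-Step-preserves inv′ steps
  ...   | inv⋆ , same′ = inv⋆ , λ Q → same′ Q ⇔-∘ same Q

  Completion-AllRook : {P : Config n} → IsPLSC P → AllRook P → (Q : Cell n → Bool) →
    Completion P Q ⇔ ((c : Cell n) → (Q c ≡ true) ⇔ (P c ≡ rook))
  Completion-AllRook {P} plsc allRook Q = mk⇔ to from
    where
    to : Completion P Q → (c : Cell n) → (Q c ≡ true) ⇔ (P c ≡ rook)
    to (lines , rook⊆ , _) c@(_ , y , z) = mk⇔ Q⊆rook (rook⊆ c)
      where
      Q⊆rook : Q c ≡ true → P c ≡ rook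
      Q⊆rook Qc with allRook (dx , y , z) | lines (dx , y , z)
      ... | r , or , Pr | _ , _ , _ , unique =
        subst (λ x → P x ≡ rook) (trans (unique r or (rook⊆ r Pr)) (sym (unique c (refl , refl) Qc))) Pr
    from : ((c : Cell n) → (Q c ≡ true) ⇔ (P c ≡ rook)) → Completion P Q
    from Q≡rooks = lines , (λ c → Equivalence.from (Q≡rooks c)) , (λ c Qc → inj₁ (Equivalence.to (Q≡rooks c) Qc))
      where
      lines : ∀ (L : Line n) → ∃ λ c → OnLine L c × (Q c ≡ true) ×
                (∀ c′ → OnLine L c′ → Q c′ ≡ true → c′ ≡ c)
      lines L with allRook L
      ... | r , or , Pr = r , or , Equivalence.from (Q≡rooks r) Pr ,
            λ c′ oc′ Qc′ → plsc L c′ r oc′ or (Equivalence.to (Q≡rooks c′) Qc′) Pr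

mainTheorem6 : (n : ℕ) (P P⋆ : Config n) → IsPLSC P → AutoEliminated P →
    PrimaryExtension P P⋆ → ¬ HasEliminatedFile P⋆ →
    ((Q : Cell n → Bool) → Completion P Q ⇔ Completion P⋆ Q) ×
    (AllRook P⋆ → (Q : Cell n → Bool) →
      Completion P Q ⇔ ((c : Cell n) → (Q c ≡ true) ⇔ (P⋆ c ≡ rook)))
mainTheorem6 n P P⋆ plsc ae (run , _) _ with Star-Step-preserves (plsc , ae) run
... | (plsc⋆ , _) , same = same , λ allRook Q → Completion-AllRook plsc⋆ allRook Q ⇔-∘ same Q
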